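{- Let $P,Q$ be integers with $P\ge 2$, $Q\neq 0$, $-P-1\le Q\le P-1$ and $D=P^2-4Q>0$, let $\alpha=\frac{P+\sqrt D}{2}$, $\beta=\frac{P-\sqrt D}{2}$ with $\alpha/\beta$ not a root of unity. Let $(a,b,c,d)\in A$, put $e=d/c$ and $$B_0=\min_{I\in\mathbb Z}\left|\alpha^I-\frac{d}{c\sqrt D}\right|.$$ Then $B_0\neq 0$ unless one of the following holds (where $I$ is the integer with $\alpha^I=\frac{d}{c\sqrt D}$): - $P=3,Q=2$ (so $\alpha=2$, $\sqrt D=1$), $e=1$, $I=0$; - $P=3,Q=2$ (so $\alpha=2$, $\sqrt D=1$), $e=2$, $I=1$; - $P=4,Q=3$ (so $\alpha=3$, $\sqrt D=2$), $e=2$, $I=0$; - $P=5,Q=4$ (so $\alpha=4$, $\sqrt D=3$), $e=3$, $I=0$.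
   Context: $A=\{(1,1,1,1),(1,1,1,3),(1,1,2,2),(1,1,2,4),(1,2,3,6),(1,1,5,5)\}$; note that $e=d/c\in\{1,2,3\}$ for tuples in $A$. -}

module Defs where

open import Data.Nat as ℕ using (ℕ; zero; suc)
open import Data.Integer using (ℤ; +_; -[1+_]; _+_; _*_; _-_; -_; _≤_; 0ℤ; 1ℤ)
open import Data.Product using (_×_; _,_; proj₁; proj₂)
open import Data.List using (List; []; _∷_)
open import Relation.Binary.PropositionalEquality using (_≡_)

A : List (ℕ × ℕ × ℕ × ℕ)
A = (1 , 1 , 1 , 1) ∷ (1 , 1 , 1 , 3) ∷ (1 , 1 , 2 , 2) ∷ (1 , 1 , 2 , 4)
  ∷ (1 , 2 , 3 , 6) ∷ (1 , 1 , 5 , 5) ∷ []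

-- Formal elements x + y·√D of ℤ[√D], represented as pairs (x , y) of integers.
-- The real number √D is the positive square root of the fixed D > 0.
ZS : Set
ZS = ℤ × ℤ

mulS : ℤ → ZS → ZS → ZS
mulS D (x , y) (x' , y') = (x * x' + D * (y * y') , x * y' + y * x')

powS : ℤ → ZS → ℕ → ZS
powS D z zero    = (1ℤ , 0ℤ)
powS D z (suc n) = mulS D z (powS D z n)

-- Equality of the REAL numbers x + y√D and x' + y'√D (√D the positive root):
-- x - x' = (y' - y)√D  iff  (x-x')² = D (y'-y)²  and  (x-x')(y'-y) ≥ 0.
-- (This is correct also when D is a perfect square.)
RealEq : ℤ → ZS → ZS → Set
RealEq D (x , y) (x' , y') =
  (0ℤ ≤ (x - x') * (y' - y)) × ((x - x') * (x - x') ≡ D * ((y' - y) * (y' - y)))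

disc : ℤ → ℤ → ℤ
disc P Q = P * P - (+ 4) * Q

-- α/β is a root of unity: since α/β is real and β ≠ 0, this means α^k = β^k for
-- some k ≥ 1, i.e. (P+√D)^k = (P-√D)^k (multiplying by 2^k).
AlphaOverBetaRootOfUnity : ℤ → ℤ → Set
AlphaOverBetaRootOfUnity P Q =
  Data.Product.∃ λ (k : ℕ) →
    RealEq (disc P Q) (powS (disc P Q) (P , 1ℤ) (suc k))
                      (powS (disc P Q) (P , - 1ℤ) (suc k))

-- α^I = d / (c √D), α = (P + √D)/2, I ∈ ℤ, c ≥ 1.
--  I = n ≥ 0 :  c·√D·(P+√D)^n = d·2^n
--  I = -m < 0:  c·√D·2^m = d·(P+√D)^m
AlphaPowEq : ℤ → ℤ → ℤ → ℕ → ℕ → Set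
AlphaPowEq P Q (+ n) c d =
  RealEq (disc P Q) (mulS (disc P Q) (0ℤ , + c) (powS (disc P Q) (P , 1ℤ) n))
                    (+ d * + (2 ℕ.^ n) , 0ℤ)
AlphaPowEq P Q -[1+ n ] c d =
  RealEq (disc P Q) (0ℤ , + c * + (2 ℕ.^ suc n))
                    (mulS (disc P Q) (+ d , 0ℤ) (powS (disc P Q) (P , 1ℤ) (suc n)))

{-# OPTIONS --safe #-}
module Submission where

-- Since α^I = d / (c√D) and the rational part of (P + √D)^|I| is positive, √D must be
-- rational, hence an integer t, and D = P² − 4Q = t² with the bounds on Q leaves two shapes.
-- If Q > 0 then (P, Q) = (t + 2, t + 1), α = t + 1 and the equation becomes t (t + 1)^I = e
-- with e = d / c ∈ {1, 2, 3}, which has exactly the four listed solutions.  If Q < 0 then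
-- Q = −(P + 1), α = P + 1 and (P + 2)(P + 1)^I = e has none.

module Squares where

  open import Data.Nat
  open import Data.Nat.Properties
  open import Data.Nat.Divisibility using (divides; ∣-refl)
  open import Data.Nat.GCD using (gcd; GCD; gcd-GCD; gcd[m,n]∣m; gcd[m,n]∣n; gcd[m,n]≢0; GCD-*)
  open import Data.Nat.Coprimality using (Coprime; GCD≡1⇒coprime; coprime-divisor)
  import Data.Nat.Coprimality as Coprime
  open import Data.Nat.Tactic.RingSolver using (solve)
  open import Data.List using (_∷_; [])
  open import Data.Product using (∃-syntax; _×_; _,_)
  open import Data.Sum using (inj₂)
  open import Data.Empty using (⊥-elim)
  open import Relation.Binary.Definitions using (tri<; tri≈; tri>)
  open import Relation.Binary.PropositionalEquality
  open import Relation.Nullary using (yes; no)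

  *-self-injective : ∀ m n → m * m ≡ n * n → m ≡ n
  *-self-injective m n eq with <-cmp m n
  ... | tri< m<n _ _ = ⊥-elim (<-irrefl eq (*-mono-< m<n m<n))
  ... | tri≈ _ m≡n _ = m≡n
  ... | tri> _ _ n<m = ⊥-elim (<-irrefl (sym eq) (*-mono-< n<m n<m))

  *-self-cancel-< : ∀ m n → m * m < n * n → m < n
  *-self-cancel-< m n m²<n² with m <? n
  ... | yes m<n = m<n
  ... | no m≮n = ⊥-elim (<⇒≱ m²<n² (*-mono-≤ (≮⇒≥ m≮n) (≮⇒≥ m≮n)))

  *-self-+-<⇒< : ∀ m k n → m * m + suc k ≡ n * n → m < n
  *-self-+-<⇒< m k n eq = *-self-cancel-< m n (≤-trans (m<m+n (m * m) z<s) (≤-reflexive eq))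

  1+n≡t*t⇒1≤t : ∀ n t → suc n ≡ t * t → 1 ≤ t
  1+n≡t*t⇒1≤t n (suc t) _ = s≤s z≤n

  -- Divide a and b by their gcd g: the quotients a′, b′ are coprime and a′² = D b′²,
  -- so b′ ∣ a′² forces b′ ∣ a′, hence b′ = 1.
  square-ratio⇒square : ∀ a b D → a * a ≡ D * (b * b) → b ≢ 0 → ∃[ t ] D ≡ t * t
  square-ratio⇒square a b D a²≡Db² b≢0
    with gcd[m,n]∣m a b | gcd[m,n]∣n a b
  ... | divides a′ a≡a′g | divides b′ b≡b′g = a′ , sym (begin
    a′ * a′        ≡⟨ a′²≡Db′² ⟩
    D * (b′ * b′)  ≡⟨ cong (λ x → D * (x * x)) b′≡1 ⟩
    D * 1          ≡⟨ *-identityʳ D ⟩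
    D              ∎)
    where
    open ≡-Reasoning
    g = gcd a b
    instance
      g≢0 : NonZero g
      g≢0 = ≢-nonZero (gcd[m,n]≢0 a b (inj₂ b≢0))
    coprime : Coprime a′ b′
    coprime = GCD≡1⇒coprime (GCD-* (subst₂ (λ x y → GCD x y (1 * g)) a≡a′g b≡b′g
                (subst (GCD a b) (sym (*-identityˡ g)) (gcd-GCD a b))))
    a′²≡Db′² : a′ * a′ ≡ D * (b′ * b′)
    a′²≡Db′² = *-cancelʳ-≡ _ _ (g * g) {{m*n≢0 g g}} (begin
      a′ * a′ * (g * g)          ≡⟨ [m*n]*[o*p]≡[m*o]*[n*p] a′ g a′ g ⟨
      (a′ * g) * (a′ * g)        ≡⟨ cong₂ _*_ a≡a′g a≡a′g ⟨
      a * a                      ≡⟨ a²≡Db² ⟩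
      D * (b * b)                ≡⟨ cong₂ (λ x y → D * (x * y)) b≡b′g b≡b′g ⟩
      D * ((b′ * g) * (b′ * g))  ≡⟨ cong (D *_) ([m*n]*[o*p]≡[m*o]*[n*p] b′ g b′ g) ⟩
      D * ((b′ * b′) * (g * g))  ≡⟨ *-assoc D _ _ ⟨
      D * (b′ * b′) * (g * g)    ∎)
    b′≡1 : b′ ≡ 1
    b′≡1 = coprime (coprime-divisor (Coprime.sym coprime)
             (divides (D * b′) (trans a′²≡Db′² (sym (*-assoc D b′ b′)))) , ∣-refl)

  -- Writing y = x + r gives 4(q + 1) = r(2x + r): odd r is impossible by parity,
  -- and r ≥ 4 makes the right-hand side exceed 4y.
  square-gap : ∀ x q y → x * x + 4 * suc q ≡ y * y → 1 ≤ x → q < y → y ≡ 2 + x × q ≡ x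
  square-gap x@(suc x′) q y x²+4[q+1]≡y² _ q<y
    with m≤n⇒∃[o]m+o≡n (<⇒≤ (*-self-+-<⇒< x _ y x²+4[q+1]≡y²))
  ... | r , refl = gap r (+-cancelˡ-≡ (x * x) _ _ (trans x²+4[q+1]≡y² (solve (x′ ∷ r ∷ [])))) q<y
    where
    4[q+1]≡2*[2*[q+1]] : 4 * suc q ≡ 2 * (2 * suc q)
    4[q+1]≡2*[2*[q+1]] = solve (q ∷ [])
    4[q+1]-even : ∀ k → 4 * suc q ≢ suc (2 * k)
    4[q+1]-even k eq = even≢odd (2 * suc q) k (trans (sym 4[q+1]≡2*[2*[q+1]]) eq)
    gap : ∀ r → 4 * suc q ≡ 2 * x * r + r * r → q < x + r → x + r ≡ 2 + x × q ≡ x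
    gap 0 h _ with trans h (cong (_+ 0) (*-zeroʳ (2 * x)))
    ... | ()
    gap 1 h _ = ⊥-elim (4[q+1]-even x (trans h (solve (x′ ∷ []))))
    gap 2 h _ = +-comm x 2 , suc-injective (*-cancelˡ-≡ (suc q) (suc x) 4 (trans h (solve (x′ ∷ []))))
    gap 3 h _ = ⊥-elim (4[q+1]-even (3 * x + 4) (trans h (solve (x′ ∷ []))))
    gap r@(suc (suc (suc (suc r′)))) h q<x+r = ⊥-elim (m+1+n≰m (4 * (x + r)) (begin
      4 * (x + r) + suc (3 + 4 * x′ + 2 * x * r′ + 4 * r′ + r′ * r′) ≡⟨ solve (x′ ∷ r′ ∷ []) ⟩
      2 * x * r + r * r                                                ≡⟨ h ⟨
      4 * suc q                                                        ≤⟨ *-monoʳ-≤ 4 q<x+r ⟩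
      4 * (x + r)                                                      ∎))
      where open ≤-Reasoning

module RationalPowers where

  open import Data.Nat
  open import Data.Nat.Properties
  open import Data.Nat.Divisibility using (_∣_; ∣n⇒∣m*n; m∣m*n; ∣m+n∣m⇒∣n; ∣-refl; ∣1⇒≡1; >⇒∤)
  open import Data.Integer.Base using (ℤ; +_; -[1+_])
  open import Data.Product using (_×_; _,_)
  open import Data.Sum using (_⊎_; inj₁; inj₂)
  open import Data.Empty using (⊥; ⊥-elim)
  open import Relation.Binary.PropositionalEquality

  ^-distribʳ-* : ∀ m n k → (m * n) ^ k ≡ m ^ k * n ^ k
  ^-distribʳ-* m n zero    = refl
  ^-distribʳ-* m n (suc k) =
    trans (cong (m * n *_) (^-distribʳ-* m n k)) ([m*n]*[o*p]≡[m*o]*[n*p] m n (m ^ k) (n ^ k))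

  -- x (a / b) ^ I ≡ y, with the denominators cleared
  RatPowEq : ℕ → ℕ → ℤ → ℕ → ℕ → Set
  RatPowEq a b (+ n)    x y = x * a ^ n ≡ y * b ^ n
  RatPowEq a b -[1+ m ] x y = x * b ^ suc m ≡ y * a ^ suc m

  *-^-cancelʳ : ∀ x y a b c k n .{{_ : NonZero c}} .{{_ : NonZero k}} →
                x * c * (a * k) ^ n ≡ y * c * (b * k) ^ n → x * a ^ n ≡ y * b ^ n
  *-^-cancelʳ x y a b c k n eq = *-cancelʳ-≡ _ _ (c * k ^ n) (begin
    x * a ^ n * (c * k ^ n)   ≡⟨ [m*n]*[o*p]≡[m*o]*[n*p] x c (a ^ n) (k ^ n) ⟨
    x * c * (a ^ n * k ^ n)   ≡⟨ cong (x * c *_) (^-distribʳ-* a k n) ⟨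
    x * c * (a * k) ^ n       ≡⟨ eq ⟩
    y * c * (b * k) ^ n       ≡⟨ cong (y * c *_) (^-distribʳ-* b k n) ⟩
    y * c * (b ^ n * k ^ n)   ≡⟨ [m*n]*[o*p]≡[m*o]*[n*p] y c (b ^ n) (k ^ n) ⟩
    y * b ^ n * (c * k ^ n)   ∎)
    where
    open ≡-Reasoning
    instance
      kⁿ≢0 : NonZero (k ^ n)
      kⁿ≢0 = m^n≢0 k n
      cᵏⁿ≢0 : NonZero (c * k ^ n)
      cᵏⁿ≢0 = m*n≢0 c (k ^ n)

  RatPowEq-cancel : ∀ a b k I x y c .{{_ : NonZero c}} .{{_ : NonZero k}} →
                    RatPowEq (a * k) (b * k) I (x * c) (y * c) → RatPowEq a b I x y
  RatPowEq-cancel a b k (+ n)    x y c = *-^-cancelʳ x y a b c k n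
  RatPowEq-cancel a b k -[1+ m ] x y c = *-^-cancelʳ x y b a c k (suc m)

  RatPowEq-halve : ∀ a u I x y c .{{_ : NonZero c}} → a ≡ u * 2 →
                   RatPowEq a 2 I (x * c) (y * c) → RatPowEq u 1 I x y
  RatPowEq-halve _ u I x y c refl = RatPowEq-cancel u 1 2 I x y c

  RatPowEq-integral-+ : ∀ u n x y → RatPowEq u 1 (+ n) x y → x * u ^ n ≡ y
  RatPowEq-integral-+ u n x y eq = trans eq (trans (cong (y *_) (^-zeroˡ n)) (*-identityʳ y))

  RatPowEq-integral-∣ : ∀ u m x y → RatPowEq u 1 -[1+ m ] x y → u ∣ x
  RatPowEq-integral-∣ u m x y eq = subst (u ∣_) x≡yuᵐ⁺¹ (∣n⇒∣m*n y (m∣m*n (u ^ m)))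
    where
    x≡yuᵐ⁺¹ : y * u ^ suc m ≡ x
    x≡yuᵐ⁺¹ = trans (sym eq) (trans (cong (x *_) (^-zeroˡ (suc m))) (*-identityʳ x))

  t[1+t]ⁿ≤3-solutions : ∀ t n e → 1 ≤ t → e ≤ 3 → t * suc t ^ n ≡ e →
      (t ≡ 1 × e ≡ 1 × + n ≡ + 0) ⊎ (t ≡ 1 × e ≡ 2 × + n ≡ + 1)
    ⊎ (t ≡ 2 × e ≡ 2 × + n ≡ + 0) ⊎ (t ≡ 3 × e ≡ 3 × + n ≡ + 0)
  t[1+t]ⁿ≤3-solutions 1 0 _ _ _ refl = inj₁ (refl , refl , refl)
  t[1+t]ⁿ≤3-solutions 2 0 _ _ _ refl = inj₂ (inj₂ (inj₁ (refl , refl , refl)))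
  t[1+t]ⁿ≤3-solutions 3 0 _ _ _ refl = inj₂ (inj₂ (inj₂ (refl , refl , refl)))
  t[1+t]ⁿ≤3-solutions (suc (suc (suc (suc _)))) 0 _ _ (s≤s (s≤s (s≤s ()))) refl
  t[1+t]ⁿ≤3-solutions 1 1 _ _ _ refl = inj₂ (inj₁ (refl , refl , refl))
  t[1+t]ⁿ≤3-solutions 1 (suc (suc n)) _ _ e≤3 refl =
    ⊥-elim (<⇒≱ (*-monoʳ-≤ 1 (*-monoʳ-≤ 2 (*-monoʳ-≤ 2 (m^n>0 2 n)))) e≤3)
  t[1+t]ⁿ≤3-solutions (suc (suc t)) (suc n) _ _ e≤3 refl =
    ⊥-elim (<⇒≱ (≤-trans (s≤s (s≤s (s≤s (s≤s z≤n))))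
                   (*-mono-≤ {2} {2 + t} (s≤s (s≤s z≤n))
                      (*-mono-≤ {3} {3 + t} (s≤s (s≤s (s≤s z≤n))) (m^n>0 (3 + t) n))))
                e≤3)

  RatPowEq[1+t,1]-solutions : ∀ t e I → 1 ≤ t → e ≤ 3 → RatPowEq (suc t) 1 I t e →
      (t ≡ 1 × e ≡ 1 × I ≡ + 0) ⊎ (t ≡ 1 × e ≡ 2 × I ≡ + 1)
    ⊎ (t ≡ 2 × e ≡ 2 × I ≡ + 0) ⊎ (t ≡ 3 × e ≡ 3 × I ≡ + 0)
  RatPowEq[1+t,1]-solutions t e -[1+ m ] 1≤t _ eq =
    ⊥-elim (>⇒∤ {{>-nonZero 1≤t}} (n<1+n t) (RatPowEq-integral-∣ (suc t) m t e eq))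
  RatPowEq[1+t,1]-solutions t e (+ n) 1≤t e≤3 eq =
    t[1+t]ⁿ≤3-solutions t n e 1≤t e≤3 (RatPowEq-integral-+ (suc t) n t e eq)

  RatPowEq[1+p,1]-unsolvable : ∀ p e I → 2 ≤ p → e ≤ 3 → RatPowEq (suc p) 1 I (2 + p) e → ⊥
  RatPowEq[1+p,1]-unsolvable p e (+ n) 2≤p e≤3 eq = <⇒≱ (begin
    4                   ≤⟨ s≤s (s≤s 2≤p) ⟩
    2 + p               ≤⟨ m≤m*n (2 + p) (suc p ^ n) {{m^n≢0 (suc p) n}} ⟩
    (2 + p) * suc p ^ n ≡⟨ RatPowEq-integral-+ (suc p) n (2 + p) e eq ⟩
    e                   ∎) e≤3
    where open ≤-Reasoning
  RatPowEq[1+p,1]-unsolvable p e -[1+ m ] (s≤s (s≤s _)) _ eq = 1+n≢0 (suc-injective (∣1⇒≡1 1+p∣1))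
    where
    1+p∣1 : suc p ∣ 1
    1+p∣1 = ∣m+n∣m⇒∣n (subst (suc p ∣_) (+-comm 1 (suc p)) (RatPowEq-integral-∣ (suc p) m (2 + p) e eq))
                      ∣-refl

open import Defs
import Data.Nat
open import Data.Nat as ℕ using (ℕ; zero; suc; s≤s; z≤n)
import Data.Nat.Properties as ℕₚ
open import Data.Integer using (ℤ; +_; -[1+_]; +[1+_]; _+_; _*_; _-_; -_; _≤_; _<_; 0ℤ; 1ℤ; ∣_∣; _^_; +≤+; -≤-; +<+)
open import Data.Integer.Properties
  using (pos-+; pos-*; +-injective; abs-*; ∣i∣≡0⇒i≡0; i-j≡0⇒i≡j; i*j≡0⇒i≡0∨j≡0; *-zeroʳ; *-identityʳ;
         +-identityˡ; +-identityʳ; *-assoc; neg-distribʳ-*)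
open import Data.Integer.Tactic.RingSolver using (solve)
import Data.Nat.Tactic.RingSolver as ℕ-Solver
open import Data.List using (_∷_; [])
open import Data.Product using (_×_; _,_; proj₁; proj₂; ∃-syntax; ∃₂)
open import Data.Sum using (_⊎_; inj₁; inj₂; reduce)
open import Data.Empty using (⊥; ⊥-elim)
open import Data.List.Membership.Propositional using (_∈_)
open import Data.List.Relation.Unary.Any using (here; there)
open import Relation.Binary.PropositionalEquality
open import Relation.Nullary using (¬_; yes; no)
open Squares
open RationalPowers

pos-^ : ∀ m n → + (m ℕ.^ n) ≡ (+ m) ^ n
pos-^ m zero    = refl
pos-^ m (suc n) = trans (pos-* m (m ℕ.^ n)) (cong (+ m *_) (pos-^ m n))

0≤i*j⇒∣i∣≡n*∣j∣⇒i≡n*j : ∀ n i j → 0ℤ ≤ i * j → ∣ i ∣ ≡ n ℕ.* ∣ j ∣ → i ≡ + n * j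
0≤i*j⇒∣i∣≡n*∣j∣⇒i≡n*j n (+ x)      (+ y)      _  eq = trans (cong +_ eq) (pos-* n y)
0≤i*j⇒∣i∣≡n*∣j∣⇒i≡n*j n (+ zero)   -[1+ y ]   _  eq with ℕₚ.m*n≡0⇒m≡0∨n≡0 n (sym eq)
... | inj₁ refl = refl
0≤i*j⇒∣i∣≡n*∣j∣⇒i≡n*j n +[1+ x ]   -[1+ y ]   () _
0≤i*j⇒∣i∣≡n*∣j∣⇒i≡n*j n -[1+ x ]   (+ zero)   _  eq with trans eq (ℕₚ.*-zeroʳ n)
... | ()
0≤i*j⇒∣i∣≡n*∣j∣⇒i≡n*j n -[1+ x ]   +[1+ y ]   () _
0≤i*j⇒∣i∣≡n*∣j∣⇒i≡n*j n -[1+ x ]   -[1+ y ]   _  eq =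
  trans (cong (λ m → - (+ m)) eq) (trans (cong -_ (pos-* n (suc y))) (neg-distribʳ-* (+ n) (+ suc y)))

-- The real number x + y√D, in case √D is the integer s.
evalAt : ℤ → ZS → ℤ
evalAt s (x , y) = x + s * y

evalAt-[x,0] : ∀ s x → evalAt s (x , 0ℤ) ≡ x
evalAt-[x,0] s x = trans (cong (_+_ x) (*-zeroʳ s)) (+-identityʳ x)

evalAt-[0,y] : ∀ s y → evalAt s (0ℤ , y) ≡ s * y
evalAt-[0,y] s y = +-identityˡ (s * y)

evalAt-mulS : ∀ {D} s → D ≡ s * s → ∀ z w → evalAt s (mulS D z w) ≡ evalAt s z * evalAt s w
evalAt-mulS s refl (x , y) (x′ , y′) = expand
  where
  expand : x * x′ + s * s * (y * y′) + s * (x * y′ + y * x′) ≡ (x + s * y) * (x′ + s * y′)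
  expand = solve (s ∷ x ∷ y ∷ x′ ∷ y′ ∷ [])

evalAt-powS : ∀ {D} s → D ≡ s * s → ∀ z n → evalAt s (powS D z n) ≡ evalAt s z ^ n
evalAt-powS s D≡s² z zero    = evalAt-[x,0] s 1ℤ
evalAt-powS s D≡s² z (suc n) =
  trans (evalAt-mulS s D≡s² z _) (cong (evalAt s z *_) (evalAt-powS s D≡s² z n))

[2α]^ : ℕ → ℕ → ℕ → ZS
[2α]^ D p n = powS (+ D) (+ p , 1ℤ) n

evalAt-mulS-powS : ∀ t p z n →
  evalAt (+ t) (mulS (+ (t ℕ.* t)) z ([2α]^ (t ℕ.* t) p n)) ≡ evalAt (+ t) z * + ((p ℕ.+ t) ℕ.^ n)
evalAt-mulS-powS t p z n = begin
  evalAt (+ t) (mulS D z αⁿ)             ≡⟨ evalAt-mulS (+ t) (pos-* t t) z αⁿ ⟩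
  evalAt (+ t) z * evalAt (+ t) αⁿ       ≡⟨ cong (evalAt (+ t) z *_) (evalAt-powS (+ t) (pos-* t t) (+ p , 1ℤ) n) ⟩
  evalAt (+ t) z * (+ p + + t * 1ℤ) ^ n  ≡⟨ cong (λ s → evalAt (+ t) z * (+ p + s) ^ n) (*-identityʳ (+ t)) ⟩
  evalAt (+ t) z * (+ p + + t) ^ n       ≡⟨ cong (λ s → evalAt (+ t) z * s ^ n) (pos-+ p t) ⟨
  evalAt (+ t) z * (+ (p ℕ.+ t)) ^ n     ≡⟨ cong (evalAt (+ t) z *_) (pos-^ (p ℕ.+ t) n) ⟨
  evalAt (+ t) z * + ((p ℕ.+ t) ℕ.^ n)   ∎
  where
  open ≡-Reasoning
  D = + (t ℕ.* t)
  αⁿ = [2α]^ (t ℕ.* t) p n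

x-x′≡s[y′-y]⇒evalAt≡ : ∀ s x y x′ y′ → x - x′ ≡ s * (y′ - y) → evalAt s (x , y) ≡ evalAt s (x′ , y′)
x-x′≡s[y′-y]⇒evalAt≡ s x y x′ y′ eq = begin
  x + s * y                    ≡⟨ solve (s ∷ x ∷ y ∷ x′ ∷ []) ⟩
  (x - x′) + (x′ + s * y)      ≡⟨ cong (_+ (x′ + s * y)) eq ⟩
  s * (y′ - y) + (x′ + s * y)  ≡⟨ solve (s ∷ y ∷ x′ ∷ y′ ∷ []) ⟩
  x′ + s * y′                  ∎
  where open ≡-Reasoning

abs-square-ratio : ∀ D i j → i * i ≡ + D * (j * j) → ∣ i ∣ ℕ.* ∣ i ∣ ≡ D ℕ.* (∣ j ∣ ℕ.* ∣ j ∣)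
abs-square-ratio D i j eq = begin
  ∣ i ∣ ℕ.* ∣ i ∣          ≡⟨ abs-* i i ⟨
  ∣ i * i ∣                ≡⟨ cong ∣_∣ eq ⟩
  ∣ + D * (j * j) ∣        ≡⟨ abs-* (+ D) (j * j) ⟩
  D ℕ.* ∣ j * j ∣          ≡⟨ cong (D ℕ.*_) (abs-* j j) ⟩
  D ℕ.* (∣ j ∣ ℕ.* ∣ j ∣)  ∎
  where open ≡-Reasoning

-- If the √D-coordinates differ, a² = D b² with b ≠ 0 makes D a perfect square.
RealEq⇒≡⊎square : ∀ D u v → RealEq (+ D) u v →
                  u ≡ v ⊎ ∃[ t ] (D ≡ t ℕ.* t × evalAt (+ t) u ≡ evalAt (+ t) v)
RealEq⇒≡⊎square D (x , y) (x′ , y′) (0≤XY , X²≡DY²) with ∣ y′ - y ∣ ℕ.≟ 0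
... | yes ∣Y∣≡0 = inj₁ (cong₂ _,_ (i-j≡0⇒i≡j x x′ X≡0) (sym (i-j≡0⇒i≡j y′ y Y≡0)))
  where
  Y≡0 : y′ - y ≡ 0ℤ
  Y≡0 = ∣i∣≡0⇒i≡0 ∣Y∣≡0
  X≡0 : x - x′ ≡ 0ℤ
  X≡0 = reduce (i*j≡0⇒i≡0∨j≡0 (x - x′)
          (trans X²≡DY² (trans (cong (λ Y → + D * (Y * Y)) Y≡0) (*-zeroʳ (+ D)))))
... | no ∣Y∣≢0
  with square-ratio⇒square ∣ x - x′ ∣ ∣ y′ - y ∣ D (abs-square-ratio D (x - x′) (y′ - y) X²≡DY²) ∣Y∣≢0
...   | t , refl = inj₂ (t , refl , x-x′≡s[y′-y]⇒evalAt≡ (+ t) x y x′ y′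
          (0≤i*j⇒∣i∣≡n*∣j∣⇒i≡n*j t (x - x′) (y′ - y) 0≤XY
            (*-self-injective ∣ x - x′ ∣ (t ℕ.* ∣ y′ - y ∣)
              (trans (abs-square-ratio (t ℕ.* t) (x - x′) (y′ - y) X²≡DY²)
                     (ℕₚ.[m*n]*[o*p]≡[m*o]*[n*p] t t ∣ y′ - y ∣ ∣ y′ - y ∣)))))

mulS-ℕ : ∀ D a b a′ b′ →
  mulS (+ D) (+ a , + b) (+ a′ , + b′) ≡ (+ (a ℕ.* a′ ℕ.+ D ℕ.* (b ℕ.* b′)) , + (a ℕ.* b′ ℕ.+ b ℕ.* a′))
mulS-ℕ D a b a′ b′ = sym (cong₂ _,_
  (trans (pos-+ (a ℕ.* a′) _)
         (cong₂ _+_ (pos-* a a′) (trans (pos-* D (b ℕ.* b′)) (cong (+ D *_) (pos-* b b′)))))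
  (trans (pos-+ (a ℕ.* b′) _) (cong₂ _+_ (pos-* a b′) (pos-* b a′))))

[2α]^-natural : ∀ D p n → ∃₂ λ a b → [2α]^ D (suc p) n ≡ (+ suc a , + b)
[2α]^-natural D p zero = 0 , 0 , refl
[2α]^-natural D p (suc n) with [2α]^-natural D p n
... | a , b , eq = _ , _ , trans (cong (mulS (+ D) (+ suc p , 1ℤ)) eq) (mulS-ℕ D (suc p) 1 (suc a) b)

√D-part-≢0 : ∀ D p c n → proj₂ (mulS (+ D) (0ℤ , + suc c) ([2α]^ D (suc p) n)) ≢ 0ℤ
√D-part-≢0 D p c n with [2α]^ D (suc p) n | [2α]^-natural D p n
... | _ | a , b , refl =
  λ eq → ℕₚ.1+n≢0 (+-injective (trans (cong proj₂ (sym (mulS-ℕ D 0 (suc c) (suc a) b))) eq))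

rational-part-≢0 : ∀ D p d n → proj₁ (mulS (+ D) (+ suc d , 0ℤ) ([2α]^ D (suc p) n)) ≢ 0ℤ
rational-part-≢0 D p d n with [2α]^ D (suc p) n | [2α]^-natural D p n
... | _ | a , b , refl =
  λ eq → ℕₚ.1+n≢0 (+-injective (trans (cong proj₁ (sym (mulS-ℕ D (suc d) 0 (suc a) b))) eq))

-- The coordinates cannot agree because (P + √D)ⁿ has positive rational part, so √D is an
-- integer t and, after multiplying by 2^|I|, both sides are natural numbers.
c√Dαⁿ≡d⇒RatPowEq : ∀ D p c d n →
  RealEq (+ D) (mulS (+ D) (0ℤ , + suc c) ([2α]^ D (suc p) n)) (+ suc d * + (2 ℕ.^ n) , 0ℤ) →
  ∃[ t ] (D ≡ t ℕ.* t × RatPowEq (suc p ℕ.+ t) 2 (+ n) (t ℕ.* suc c) (suc d))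
c√Dαⁿ≡d⇒RatPowEq D p c d n eq
  with RealEq⇒≡⊎square D (mulS (+ D) (0ℤ , + suc c) ([2α]^ D (suc p) n)) (+ suc d * + (2 ℕ.^ n) , 0ℤ) eq
... | inj₁ u≡v = ⊥-elim (√D-part-≢0 D p c n (cong proj₂ u≡v))
... | inj₂ (t , refl , evalEq) = t , refl , +-injective (begin
  + (t ℕ.* suc c ℕ.* (suc p ℕ.+ t) ℕ.^ n)
    ≡⟨ pos-* (t ℕ.* suc c) ((suc p ℕ.+ t) ℕ.^ n) ⟩
  + (t ℕ.* suc c) * + ((suc p ℕ.+ t) ℕ.^ n)
    ≡⟨ cong (_* + ((suc p ℕ.+ t) ℕ.^ n)) (trans (pos-* t (suc c)) (sym (evalAt-[0,y] (+ t) (+ suc c)))) ⟩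
  evalAt (+ t) (0ℤ , + suc c) * + ((suc p ℕ.+ t) ℕ.^ n)
    ≡⟨ evalAt-mulS-powS t (suc p) (0ℤ , + suc c) n ⟨
  evalAt (+ t) (mulS (+ (t ℕ.* t)) (0ℤ , + suc c) ([2α]^ (t ℕ.* t) (suc p) n))
    ≡⟨ evalEq ⟩
  evalAt (+ t) (+ suc d * + (2 ℕ.^ n) , 0ℤ)
    ≡⟨ evalAt-[x,0] (+ t) (+ suc d * + (2 ℕ.^ n)) ⟩
  + suc d * + (2 ℕ.^ n)
    ≡⟨ pos-* (suc d) (2 ℕ.^ n) ⟨
  + (suc d ℕ.* 2 ℕ.^ n)
    ∎)
  where open ≡-Reasoning

c√D≡dαᵐ⇒RatPowEq : ∀ D p c d m →
  RealEq (+ D) (0ℤ , + suc c * + (2 ℕ.^ m)) (mulS (+ D) (+ suc d , 0ℤ) ([2α]^ D (suc p) m)) →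
  ∃[ t ] (D ≡ t ℕ.* t × t ℕ.* suc c ℕ.* 2 ℕ.^ m ≡ suc d ℕ.* (suc p ℕ.+ t) ℕ.^ m)
c√D≡dαᵐ⇒RatPowEq D p c d m eq
  with RealEq⇒≡⊎square D (0ℤ , + suc c * + (2 ℕ.^ m)) (mulS (+ D) (+ suc d , 0ℤ) ([2α]^ D (suc p) m)) eq
... | inj₁ u≡v = ⊥-elim (rational-part-≢0 D p d m (sym (cong proj₁ u≡v)))
... | inj₂ (t , refl , evalEq) = t , refl , +-injective (begin
  + (t ℕ.* suc c ℕ.* 2 ℕ.^ m)
    ≡⟨ trans (pos-* (t ℕ.* suc c) (2 ℕ.^ m)) (cong (_* + (2 ℕ.^ m)) (pos-* t (suc c))) ⟩
  + t * + suc c * + (2 ℕ.^ m)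
    ≡⟨ *-assoc (+ t) (+ suc c) (+ (2 ℕ.^ m)) ⟩
  + t * (+ suc c * + (2 ℕ.^ m))
    ≡⟨ evalAt-[0,y] (+ t) (+ suc c * + (2 ℕ.^ m)) ⟨
  evalAt (+ t) (0ℤ , + suc c * + (2 ℕ.^ m))
    ≡⟨ evalEq ⟩
  evalAt (+ t) (mulS (+ (t ℕ.* t)) (+ suc d , 0ℤ) ([2α]^ (t ℕ.* t) (suc p) m))
    ≡⟨ evalAt-mulS-powS t (suc p) (+ suc d , 0ℤ) m ⟩
  evalAt (+ t) (+ suc d , 0ℤ) * + ((suc p ℕ.+ t) ℕ.^ m)
    ≡⟨ cong (_* + ((suc p ℕ.+ t) ℕ.^ m)) (evalAt-[x,0] (+ t) (+ suc d)) ⟩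
  + suc d * + ((suc p ℕ.+ t) ℕ.^ m)
    ≡⟨ pos-* (suc d) ((suc p ℕ.+ t) ℕ.^ m) ⟨
  + (suc d ℕ.* (suc p ℕ.+ t) ℕ.^ m)
    ∎)
  where open ≡-Reasoning

AlphaPowEq⇒RatPowEq : ∀ p Q D I c d → disc (+ suc p) Q ≡ + D → AlphaPowEq (+ suc p) Q I (suc c) (suc d) →
                      ∃[ t ] (D ≡ t ℕ.* t × RatPowEq (suc p ℕ.+ t) 2 I (t ℕ.* suc c) (suc d))
AlphaPowEq⇒RatPowEq p Q D (+ n) c d disc≡D αᴵ with disc (+ suc p) Q | disc≡D
... | _ | refl = c√Dαⁿ≡d⇒RatPowEq D p c d n αᴵ
AlphaPowEq⇒RatPowEq p Q D -[1+ m ] c d disc≡D αᴵ with disc (+ suc p) Q | disc≡D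
... | _ | refl = c√D≡dαᵐ⇒RatPowEq D p c d (suc m) αᴵ

disc≡D⇒D+4Q≡P² : ∀ p q D → disc (+ p) (+ suc q) ≡ + D → D ℕ.+ 4 ℕ.* suc q ≡ p ℕ.* p
disc≡D⇒D+4Q≡P² p q D eq = +-injective (begin
  + (D ℕ.+ 4 ℕ.* suc q)                 ≡⟨ pos-+ D (4 ℕ.* suc q) ⟩
  + D + + 4 * + suc q                   ≡⟨ cong (_+ + 4 * + suc q) eq ⟨
  disc (+ p) (+ suc q) + + 4 * + suc q  ≡⟨ P²-4Q+4Q≡P² (+ p) (+ suc q) ⟩
  + p * + p                             ≡⟨ pos-* p p ⟨
  + (p ℕ.* p)                           ∎)
  where
  open ≡-Reasoning
  P²-4Q+4Q≡P² : ∀ P Q → P * P - + 4 * Q + + 4 * Q ≡ P * P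
  P²-4Q+4Q≡P² P Q = solve (P ∷ Q ∷ [])

disc≡D⇒P²+4∣Q∣≡D : ∀ p q D → disc (+ p) -[1+ q ] ≡ + D → p ℕ.* p ℕ.+ 4 ℕ.* suc q ≡ D
disc≡D⇒P²+4∣Q∣≡D p q D eq = +-injective (begin
  + (p ℕ.* p ℕ.+ 4 ℕ.* suc q)  ≡⟨ pos-+ (p ℕ.* p) (4 ℕ.* suc q) ⟩
  + (p ℕ.* p) + + 4 * + suc q  ≡⟨ cong (_+ + 4 * + suc q) (pos-* p p) ⟩
  + p * + p + + 4 * + suc q    ≡⟨ P²-4[-Q]≡P²+4Q (+ p) (+ suc q) ⟨
  disc (+ p) -[1+ q ]          ≡⟨ eq ⟩
  + D                          ∎)
  where
  open ≡-Reasoning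
  P²-4[-Q]≡P²+4Q : ∀ P Q → P * P - + 4 * (- Q) ≡ P * P + + 4 * Q
  P²-4[-Q]≡P²+4Q P Q = solve (P ∷ Q ∷ [])

0<i⇒i≡+[1+n] : ∀ {i} → 0ℤ < i → ∃[ n ] i ≡ + suc n
0<i⇒i≡+[1+n] (+<+ {n = suc n} _) = n , refl

+[1+q]≤P-1⇒q<P : ∀ p q → + suc q ≤ + suc p - 1ℤ → q ℕ.< suc p
+[1+q]≤P-1⇒q<P p q (+≤+ q<p) = ℕₚ.m<n⇒m<1+n q<p

-P-1≤-[1+q]⇒q≤P : ∀ p q → - (+ suc p) - 1ℤ ≤ -[1+ q ] → q ℕ.≤ suc p
-P-1≤-[1+q]⇒q≤P p q (-≤- q≤p+0) = subst (q ℕ.≤_) (ℕₚ.+-identityʳ (suc p)) q≤p+0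

∈A⇒d≡e*c : ∀ {a b c d} → (a , b , c , d) ∈ A → ∃[ e ] (1 ℕ.≤ e × e ℕ.≤ 3 × 1 ℕ.≤ c × d ≡ e ℕ.* c)
∈A⇒d≡e*c (here refl)                                     = 1 , s≤s z≤n , s≤s z≤n , s≤s z≤n , refl
∈A⇒d≡e*c (there (here refl))                             = 3 , s≤s z≤n , s≤s (s≤s (s≤s z≤n)) , s≤s z≤n , refl
∈A⇒d≡e*c (there (there (here refl)))                     = 1 , s≤s z≤n , s≤s z≤n , s≤s z≤n , refl
∈A⇒d≡e*c (there (there (there (here refl))))             = 2 , s≤s z≤n , s≤s (s≤s z≤n) , s≤s z≤n , refl
∈A⇒d≡e*c (there (there (there (there (here refl)))))     = 2 , s≤s z≤n , s≤s (s≤s z≤n) , s≤s z≤n , refl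
∈A⇒d≡e*c (there (there (there (there (there (here refl)))))) = 1 , s≤s z≤n , s≤s z≤n , s≤s z≤n , refl
∈A⇒d≡e*c (there (there (there (there (there (there ()))))))

Exceptional : ℤ → ℤ → ℕ → ℕ → ℤ → Set
Exceptional P Q d c I = (P ≡ + 3 × Q ≡ + 2 × d ≡ 1 Data.Nat.* c × I ≡ + 0)
                      ⊎ (P ≡ + 3 × Q ≡ + 2 × d ≡ 2 Data.Nat.* c × I ≡ + 1)
                      ⊎ (P ≡ + 4 × Q ≡ + 3 × d ≡ 2 Data.Nat.* c × I ≡ + 0)
                      ⊎ (P ≡ + 5 × Q ≡ + 4 × d ≡ 3 Data.Nat.* c × I ≡ + 0)

2+n+n≡[1+n]*2 : ∀ n → 2 ℕ.+ n ℕ.+ n ≡ suc n ℕ.* 2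
2+n+n≡[1+n]*2 = ℕ-Solver.solve-∀

n+[2+n]≡[1+n]*2 : ∀ n → n ℕ.+ (2 ℕ.+ n) ≡ suc n ℕ.* 2
n+[2+n]≡[1+n]*2 = ℕ-Solver.solve-∀

-- Q > 0 forces P = t + 2, Q = t + 1, so α = t + 1 and the equation reads t (t + 1)^I = e.
Q>0⇒Exceptional : ∀ p q t I c e → disc (+ p) (+ suc q) ≡ + (t ℕ.* t) → 1 ℕ.≤ t → q ℕ.< p →
                  1 ℕ.≤ c → e ℕ.≤ 3 → RatPowEq (p ℕ.+ t) 2 I (t ℕ.* c) (e ℕ.* c) →
                  Exceptional (+ p) (+ suc q) (e ℕ.* c) c I
Q>0⇒Exceptional p q t I c e disc≡t² 1≤t q<p 1≤c e≤3 eq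
  with square-gap t q p (disc≡D⇒D+4Q≡P² p q (t ℕ.* t) disc≡t²) 1≤t q<p
... | refl , refl
  with RatPowEq[1+t,1]-solutions t e I 1≤t e≤3
         (RatPowEq-halve _ (suc t) I t e c {{ℕ.>-nonZero 1≤c}} (2+n+n≡[1+n]*2 t) eq)
... | inj₁ (refl , refl , refl)               = inj₁ (refl , refl , refl , refl)
... | inj₂ (inj₁ (refl , refl , refl))        = inj₂ (inj₁ (refl , refl , refl , refl))
... | inj₂ (inj₂ (inj₁ (refl , refl , refl))) = inj₂ (inj₂ (inj₁ (refl , refl , refl , refl)))
... | inj₂ (inj₂ (inj₂ (refl , refl , refl))) = inj₂ (inj₂ (inj₂ (refl , refl , refl , refl)))

-- Q < 0 forces D = (P + 2)², so α = P + 1 and the equation reads (P + 2)(P + 1)^I = e.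
Q<0-impossible : ∀ p q t I c e → disc (+ p) -[1+ q ] ≡ + (t ℕ.* t) → 2 ℕ.≤ p → q ℕ.≤ p →
                 1 ℕ.≤ c → e ℕ.≤ 3 → RatPowEq (p ℕ.+ t) 2 I (t ℕ.* c) (e ℕ.* c) → ⊥
Q<0-impossible p q t I c e disc≡t² 2≤p q≤p 1≤c e≤3 eq
  with square-gap p q t p²+4[q+1]≡t² (ℕₚ.≤-trans (s≤s z≤n) 2≤p)
                  (ℕₚ.≤-<-trans q≤p (*-self-+-<⇒< p _ t p²+4[q+1]≡t²))
  where p²+4[q+1]≡t² = disc≡D⇒P²+4∣Q∣≡D p q (t ℕ.* t) disc≡t²
... | refl , refl = RatPowEq[1+p,1]-unsolvable p e I 2≤p e≤3
      (RatPowEq-halve _ (suc p) I (2 ℕ.+ p) e c {{ℕ.>-nonZero 1≤c}} (n+[2+n]≡[1+n]*2 p) eq)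

theorem2 : (P Q : ℤ) → + 2 ≤ P → Q ≢ 0ℤ → - P - 1ℤ ≤ Q → Q ≤ P - 1ℤ
    → 0ℤ < disc P Q → ¬ AlphaOverBetaRootOfUnity P Q
    → (a b c d : ℕ) → (a , b , c , d) ∈ A
    → (I : ℤ) → AlphaPowEq P Q I c d
    → (P ≡ + 3 × Q ≡ + 2 × d ≡ 1 Data.Nat.* c × I ≡ + 0)
    ⊎ (P ≡ + 3 × Q ≡ + 2 × d ≡ 2 Data.Nat.* c × I ≡ + 1)
    ⊎ (P ≡ + 4 × Q ≡ + 3 × d ≡ 2 Data.Nat.* c × I ≡ + 0)
    ⊎ (P ≡ + 5 × Q ≡ + 4 × d ≡ 3 Data.Nat.* c × I ≡ + 0)
theorem2 (+ p) Q (+≤+ 2≤p@(s≤s (s≤s _))) Q≢0 lower upper 0<disc _ a b c d abcd∈A I αᴵ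
  with ∈A⇒d≡e*c abcd∈A | 0<i⇒i≡+[1+n] 0<disc
... | e , s≤s z≤n , e≤3 , 1≤c@(s≤s z≤n) , refl | D , disc≡1+D
  with AlphaPowEq⇒RatPowEq _ Q (suc D) I _ _ disc≡1+D αᴵ
... | t , 1+D≡t² , ratEq with Q | trans disc≡1+D (cong +_ 1+D≡t²)
... | + zero   | _       = ⊥-elim (Q≢0 refl)
... | + suc q  | disc≡t² = Q>0⇒Exceptional p q t I c e disc≡t² (1+n≡t*t⇒1≤t D t 1+D≡t²)
                             (+[1+q]≤P-1⇒q<P _ q upper) 1≤c e≤3 ratEq
... | -[1+ q ] | disc≡t² = ⊥-elim (Q<0-impossible p q t I c e disc≡t² 2≤p
                             (-P-1≤-[1+q]⇒q≤P _ q lower) 1≤c e≤3 ratEq)
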